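{- Assume the Erdős girth conjecture: for every positive integer $k$ and every sufficiently large positive integer $n$ there exists an $n$-vertex graph with girth $>2k$ and $\Omega(n^{1+1/k})$ edges. Then for all positive integers $k,h$ and sufficiently large $n$, there are $n$-node $K_h$-minor-free graphs $G$ for which every $(2k-1)$-spanner $H$ of $G$ has sparsity and lightness $$\Omega\left(h^{\frac{2}{k+1}}\right).$$
   Context: For a (possibly weighted) graph $G$ and a real $t\ge 1$, a $t$-spanner of $G$ is a subgraph $H\subseteq G$ on the same vertex set with $\mathrm{dist}_H(u,v)\le t\cdot \mathrm{dist}_G(u,v)$ for all vertices $u,v$. The sparsity of $H$ is $|E(H)|/n$, where $n$ is the number of vertices of $G$. The lightness of $H$ is $w(H)/w(\mathrm{MST}(G))$, where $w(\cdot)$ denotes total edge weight and $\mathrm{MST}(G)$ is a minimum spanning tree (forest) of $G$. The girth of a graph is the length of its shortest cycle. -}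

module Defs where

open import Data.Nat using (ℕ; zero; suc; _+_; _*_; _^_; _≤_; _<ᵇ_)
open import Data.Bool using (Bool; true; false; _∧_; if_then_else_)
open import Data.Fin using (Fin; toℕ)
open import Data.List using (List; []; _∷_; _++_; [_]; length; map; allFin)
open import Data.Nat.ListAction using (sum)
open import Data.List.Relation.Unary.Linked using (Linked)
open import Data.List.Relation.Unary.Unique.Propositional using (Unique)
open import Data.Maybe using (Maybe; just)
open import Data.Product using (Σ; ∃; ∃-syntax; _×_)
open import Data.Unit using (⊤)
open import Relation.Binary.PropositionalEquality using (_≡_; _≢_)
open import Relation.Nullary using (¬_)

record Graph (n : ℕ) : Set where
  field
    adj    : Fin n → Fin n → Bool
    sym    : ∀ i j → adj i j ≡ adj j i
    irrefl : ∀ i → adj i i ≡ false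
open Graph public

Adj : ∀ {n} → Graph n → Fin n → Fin n → Set
Adj G u v = adj G u v ≡ true

_⊆G_ : ∀ {n} → Graph n → Graph n → Set
H ⊆G G = ∀ u v → Adj H u v → Adj G u v

edges : ∀ {n} → Graph n → ℕ
edges {n} G =
  sum (map (λ i → sum (map (λ j → if (toℕ i <ᵇ toℕ j) ∧ adj G i j then 1 else 0)
                           (allFin n)))
           (allFin n))

data WalkIn {n} (G : Graph n) (P : Fin n → Set) : Fin n → Fin n → ℕ → Set where
  nil  : ∀ {u} → P u → WalkIn G P u u 0
  cons : ∀ {u v w ℓ} → P u → Adj G u v → WalkIn G P v w ℓ → WalkIn G P u w (suc ℓ)

Walk : ∀ {n} → Graph n → Fin n → Fin n → ℕ → Set
Walk G = WalkIn G (λ _ → ⊤)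

HasCycle : ∀ {n} → Graph n → ℕ → Set
HasCycle {n} G ℓ =
  Σ (Fin n) λ x → Σ (List (Fin n)) λ ys →
    (3 ≤ ℓ) × (length (x ∷ ys) ≡ ℓ) × Unique (x ∷ ys) × Linked (Adj G) (x ∷ ys ++ [ x ])

-- girth(G) > g   (acyclic graphs have infinite girth)
GirthGreaterThan : ∀ {n} → Graph n → ℕ → Set
GirthGreaterThan G g = ∀ ℓ → ℓ ≤ g → ¬ HasCycle G ℓ

Forest : ∀ {n} → Graph n → Set
Forest G = ∀ ℓ → ¬ HasCycle G ℓ

-- K_h minor model: φ assigns each vertex to at most one branch set (so branch
-- sets are disjoint); each branch set is nonempty and connected, and any two
-- distinct branch sets are joined by an edge.
HasCompleteMinor : ∀ {n} → Graph n → ℕ → Set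
HasCompleteMinor {n} G h =
  Σ (Fin n → Maybe (Fin h)) λ φ →
    (∀ i → ∃[ v ] φ v ≡ just i) ×
    (∀ i u v → φ u ≡ just i → φ v ≡ just i →
       ∃[ ℓ ] WalkIn G (λ x → φ x ≡ just i) u v ℓ) ×
    (∀ i j → i ≢ j → ∃[ u ] ∃[ v ] (φ u ≡ just i × φ v ≡ just j × Adj G u v))

KMinorFree : ∀ {n} → Graph n → ℕ → Set
KMinorFree G h = ¬ HasCompleteMinor G h

-- H is a t-spanner of G (t a natural number; unit edge weights):
-- H ⊆ G and dist_H(u,v) ≤ t · dist_G(u,v), i.e. every u–v walk in G of
-- length ℓ is matched by a u–v walk in H of length ≤ t·ℓ.
IsSpanner : ∀ {n} → ℕ → Graph n → Graph n → Set
IsSpanner t G H =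
  H ⊆G G × (∀ u v ℓ → Walk G u v ℓ → ∃[ ℓ' ] (Walk H u v ℓ' × ℓ' ≤ t * ℓ))

IsSpanningForest : ∀ {n} → Graph n → Graph n → Set
IsSpanningForest G T =
  T ⊆G G × Forest T × (∀ u v ℓ → Walk G u v ℓ → ∃[ ℓ' ] Walk T u v ℓ')

-- Minimum spanning forest (unit weights: weight = number of edges).
IsMSF : ∀ {n} → Graph n → Graph n → Set
IsMSF G T = IsSpanningForest G T × (∀ T' → IsSpanningForest G T' → edges T ≤ edges T')

-- Erdős girth conjecture: for every k ≥ 1 there are c = p/q > 0 and n₀ such
-- that for all n ≥ n₀ some n-vertex graph has girth > 2k and ≥ c·n^(1+1/k)
-- edges; the last inequality is stated as |E|^k ≥ c^k · n^(k+1) (c ranges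
-- over positive rationals; equivalent).
ErdosGirthConjecture : Set
ErdosGirthConjecture =
  ∀ k → 1 ≤ k →
    ∃[ p ] ∃[ q ] (1 ≤ p × 1 ≤ q × ∃[ n₀ ] (∀ n → n₀ ≤ n →
      ∃[ G ] (GirthGreaterThan {n} G (2 * k) ×
              p * n ^ (k + 1) ≤ q * edges G ^ k)))

-- A graph G of girth > 2k is its own only (2k−1)-spanner: if an edge uv of G were missing
-- from H, a shortest u–v path in H, of length ≤ 2k − 1, would close with uv a cycle of length
-- ≤ 2k. A minimum spanning forest has at most n edges, so sparsity and lightness of H are
-- both at least |E(G)|/n.
--
-- Let s be the largest integer with 2 s^(k+1) < h(h − 1). The girth conjecture provides a
-- graph on m = q s^k vertices of girth > 2k with at least s^(k+1) edges; keep exactly s^(k+1)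
-- of them to get F. A K_h minor needs a distinct arc for each of the h(h − 1) ordered pairs of
-- branch sets, and it lives in one component; hence the disjoint union G of ⌊n/m⌋ copies of F,
-- padded by a partial copy, is K_h-minor-free. Finally |E(G)|/n ≥ s/(2q), while the
-- maximality of s gives h² ≤ 4 (2s)^(k+1).

{-# OPTIONS --safe #-}
module Submission where

open import Defs renaming (sym to adj-sym)
open import Data.Bool using (Bool; true; false; _∧_; _∨_; if_then_else_)
open import Data.Bool.Properties using (T-∧; T-≡; ∨-comm; ∧-conicalˡ; ∧-conicalʳ; ∧-zeroʳ)
open import Data.Empty using (⊥-elim)
open import Data.Fin as Fin using (Fin; zero; suc; toℕ; punchIn; fromℕ<)
open import Data.Fin.Properties
  using (toℕ-injective; toℕ-fromℕ<; toℕ<n; punchIn-injective; punchIn-mono-≤; punchIn-punchOut; punchInᵢ≢i)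
  renaming (any? to anyFin?)
open import Data.List using (List; []; _∷_; _++_; [_]; length; map; filterᵇ; allFin; cartesianProduct; take)
open import Data.List.Properties
  using (length-++; length-map; length-take; length-tabulate; length-removeAt′; map-cong; map-++; map-∘)
import Data.List.Membership.DecPropositional as DecMembership
open import Data.List.Membership.Propositional using (_∈_)
open import Data.List.Membership.Propositional.Properties
  using (∈-allFin; ∈-filter⁺; ∈-filter⁻; ∈-cartesianProduct⁺; ∈-cartesianProduct⁻;
         ∈-++⁺ˡ; ∈-++⁺ʳ; ∈-map⁺)
open import Data.List.Relation.Unary.All as All using (All; []; _∷_)
import Data.List.Relation.Unary.All.Properties as Allₚ
open import Data.List.Relation.Unary.Any using (here; there; index; _─_)
open import Data.List.Relation.Unary.Linked as Linked using (Linked; [-]; _∷_)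
import Data.List.Relation.Unary.Linked.Properties as Linkedₚ
open import Data.List.Relation.Unary.Unique.Propositional using (Unique; []; _∷_)
import Data.List.Relation.Unary.Unique.Propositional.Properties as Unique
open import Data.Maybe using (just)
open import Data.Maybe.Properties using (just-injective)
open import Data.Nat
  using (ℕ; zero; suc; _+_; _*_; _^_; _∸_; _≤_; _<_; _<ᵇ_; _≡ᵇ_; _≤?_; _<?_; z≤n; s≤s; s≤s⁻¹;
         NonZero; >-nonZero; >-nonZero⁻¹)
open import Data.Nat.DivMod
  using (_/_; _%_; _mod_; m≡m%n+[m/n]*n; m%n<n; m≥n⇒m/n>0; m/n*n≤m; +-distrib-/-∣ʳ; m<n⇒m/n≡0;
         m*n/n≡m; [m+kn]%n≡m%n; m<n⇒m%n≡m)
open import Data.Nat.Divisibility using (n∣m*n)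
open import Data.Nat.ListAction using (sum)
open import Data.Nat.ListAction.Properties using (sum-++)
open import Data.Nat.Properties
open import Data.Nat.Tactic.RingSolver using (solve-∀)
open import Data.Product using (∃-syntax; _×_; _,_; proj₁; proj₂; swap)
import Data.Product as Product
open import Data.Product.Properties using () renaming (≡-dec to ×-≡-dec)
open import Data.Sum using (_⊎_; inj₁; inj₂)
open import Data.Unit using (tt)
open import Function using (_∘_; id)
open import Function.Bundles using (Equivalence)
open import Relation.Binary using (DecidableEquality)
open import Relation.Binary.Definitions using (tri<; tri≈; tri>)
open import Relation.Binary.PropositionalEquality hiding ([_])
open import Relation.Nullary using (¬_; Dec; does; yes; no)
open import Relation.Nullary.Decidable using (T?; dec-true)

private
  variable
    A B : Set
    n : ℕ

∈-─⁺ : ∀ {x z : A} {ys} (x∈ys : x ∈ ys) → z ∈ ys → z ≢ x → z ∈ (ys ─ x∈ys)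
∈-─⁺ (here refl)  (here refl)  z≢x = ⊥-elim (z≢x refl)
∈-─⁺ (here _)     (there z∈ys) _   = z∈ys
∈-─⁺ (there _)    (here refl)  _   = here refl
∈-─⁺ (there x∈ys) (there z∈ys) z≢x = there (∈-─⁺ x∈ys z∈ys z≢x)

injectiveOn⇒length-≤ : (g : A → B) {xs : List A} {ys : List B} → Unique xs →
  (∀ {x} → x ∈ xs → g x ∈ ys) →
  (∀ {x y} → x ∈ xs → y ∈ xs → g x ≡ g y → x ≡ y) →
  length xs ≤ length ys
injectiveOn⇒length-≤ g {[]}     _              _    _   = z≤n
injectiveOn⇒length-≤ g {x ∷ xs} {ys} (x∉xs ∷ xs!) into inj =
  subst (suc (length xs) ≤_) (sym (length-removeAt′ ys (index gx∈ys)))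
    (s≤s (injectiveOn⇒length-≤ g xs! into′ (λ p q → inj (there p) (there q))))
  where
  gx∈ys = into (here refl)
  into′ : ∀ {z} → z ∈ xs → g z ∈ (ys ─ gx∈ys)
  into′ z∈xs = ∈-─⁺ gx∈ys (into (there z∈xs))
    (λ gz≡gx → All.lookup x∉xs z∈xs (sym (inj (there z∈xs) (here refl) gz≡gx)))

⊆⇒length-≤ : {xs ys : List A} → Unique xs → (∀ {x} → x ∈ xs → x ∈ ys) → length xs ≤ length ys
⊆⇒length-≤ xs! xs⊆ys = injectiveOn⇒length-≤ id xs! xs⊆ys (λ _ _ → id)

length-cartesianProduct : ∀ (xs : List A) (ys : List B) → length (cartesianProduct xs ys) ≡ length xs * length ys
length-cartesianProduct []       ys = refl
length-cartesianProduct (x ∷ xs) ys =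
  trans (length-++ (map (x ,_) ys)) (cong₂ _+_ (length-map (x ,_) ys) (length-cartesianProduct xs ys))

length-allFin : ∀ n → length (allFin n) ≡ n
length-allFin n = length-tabulate id

∈-take⁻ : ∀ {x : A} k xs → x ∈ take k xs → x ∈ xs
∈-take⁻ (suc k) (y ∷ ys) (here refl) = here refl
∈-take⁻ (suc k) (y ∷ ys) (there x∈) = there (∈-take⁻ k ys x∈)

Unique-++⁻ˡ : ∀ (xs : List A) {ys} → Unique (xs ++ ys) → Unique xs
Unique-++⁻ˡ []       _            = []
Unique-++⁻ˡ (x ∷ xs) (x∉ ∷ xs!) = Allₚ.++⁻ˡ xs x∉ ∷ Unique-++⁻ˡ xs xs!

two-distinct-members : ∀ {xs : List A} → 2 ≤ length xs → Unique xs →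
  ∃[ a ] ∃[ b ] (a ≢ b × a ∈ xs × b ∈ xs)
two-distinct-members {xs = a ∷ b ∷ _} _ ((a≢b ∷ _) ∷ _) = a , b , a≢b , here refl , there (here refl)
two-distinct-members {xs = _ ∷ []} (s≤s ()) _

Unique-map⁺-on : ∀ (f : A → B) {Q : A → Set} → (∀ {a b} → Q a → Q b → f a ≡ f b → a ≡ b) →
  ∀ {xs} → All Q xs → Unique xs → Unique (map f xs)
Unique-map⁺-on f inj []         []           = []
Unique-map⁺-on f inj (qx ∷ qxs) (x∉ ∷ xs!) =
  Allₚ.map⁺ (All.zipWith (λ (qy , x≢y) fx≡fy → x≢y (inj qx qy fx≡fy)) (qxs , x∉)) ∷
  Unique-map⁺-on f inj qxs xs!

length-filterᵇ : ∀ (p : A → Bool) xs → length (filterᵇ p xs) ≡ sum (map (λ x → if p x then 1 else 0) xs)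
length-filterᵇ p []       = refl
length-filterᵇ p (x ∷ xs) with p x
... | true  = cong suc (length-filterᵇ p xs)
... | false = length-filterᵇ p xs

sum-cartesianProduct : ∀ (f : A × B → ℕ) xs ys →
  sum (map f (cartesianProduct xs ys)) ≡ sum (map (λ x → sum (map (λ y → f (x , y)) ys)) xs)
sum-cartesianProduct f []       ys = refl
sum-cartesianProduct f (x ∷ xs) ys = begin
  sum (map f (map (x ,_) ys ++ cartesianProduct xs ys))
    ≡⟨ cong sum (map-++ f (map (x ,_) ys) _) ⟩
  sum (map f (map (x ,_) ys) ++ map f (cartesianProduct xs ys))
    ≡⟨ sum-++ (map f (map (x ,_) ys)) _ ⟩
  sum (map f (map (x ,_) ys)) + sum (map f (cartesianProduct xs ys))
    ≡⟨ cong₂ _+_ (cong sum (sym (map-∘ ys))) (sum-cartesianProduct f xs ys) ⟩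
  sum (map (λ y → f (x , y)) ys) + sum (map (λ x → sum (map (λ y → f (x , y)) ys)) xs) ∎
  where open ≡-Reasoning

Adj-sym : ∀ (G : Graph n) {i j} → Adj G i j → Adj G j i
Adj-sym G {i} {j} a = trans (adj-sym G j i) a

Adj-irrefl : ∀ (G : Graph n) {i} → ¬ Adj G i i
Adj-irrefl G {i} a with () ← trans (sym a) (irrefl G i)

pairs : ∀ n → List (Fin n × Fin n)
pairs n = cartesianProduct (allFin n) (allFin n)

isEdge : Graph n → Fin n × Fin n → Bool
isEdge G (i , j) = (toℕ i <ᵇ toℕ j) ∧ adj G i j

edgeList : Graph n → List (Fin n × Fin n)
edgeList {n} G = filterᵇ (isEdge G) (pairs n)

edges≡length-edgeList : ∀ (G : Graph n) → edges G ≡ length (edgeList G)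
edges≡length-edgeList {n} G = sym (trans (length-filterᵇ (isEdge G) (pairs n))
  (sum-cartesianProduct (λ e → if isEdge G e then 1 else 0) (allFin n) (allFin n)))

Unique-edgeList : ∀ (G : Graph n) → Unique (edgeList G)
Unique-edgeList {n} G = Unique.filter⁺ (T? ∘ isEdge G)
  (Unique.cartesianProduct⁺ (Unique.allFin⁺ n) (Unique.allFin⁺ n))

∈-edgeList⁺ : ∀ (G : Graph n) {i j} → toℕ i < toℕ j → Adj G i j → (i , j) ∈ edgeList G
∈-edgeList⁺ G {i} {j} i<j a = ∈-filter⁺ (T? ∘ isEdge G)
  (∈-cartesianProduct⁺ (∈-allFin i) (∈-allFin j))
  (Equivalence.from T-∧ (<⇒<ᵇ i<j , Equivalence.from T-≡ a))

∈-edgeList⁻ : ∀ (G : Graph n) {i j} → (i , j) ∈ edgeList G → toℕ i < toℕ j × Adj G i j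
∈-edgeList⁻ {n} G {i} {j} e∈ =
  let (i<ᵇj , a) = Equivalence.to T-∧ (proj₂ (∈-filter⁻ (T? ∘ isEdge G) {xs = pairs n} e∈))
  in <ᵇ⇒< (toℕ i) (toℕ j) i<ᵇj , Equivalence.to T-≡ a

orientations : Graph n → List (Fin n × Fin n)
orientations G = edgeList G ++ map swap (edgeList G)

length-orientations : ∀ (G : Graph n) → length (orientations G) ≡ 2 * edges G
length-orientations G = begin
  length (edgeList G ++ map swap (edgeList G))          ≡⟨ length-++ (edgeList G) ⟩
  length (edgeList G) + length (map swap (edgeList G))
    ≡⟨ cong (length (edgeList G) +_) (length-map swap (edgeList G)) ⟩
  length (edgeList G) + length (edgeList G)             ≡⟨ cong (λ e → e + e) (edges≡length-edgeList G) ⟨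
  edges G + edges G                                     ≡⟨ cong (edges G +_) (+-identityʳ (edges G)) ⟨
  2 * edges G                                           ∎
  where open ≡-Reasoning

Adj⇒∈orientations : ∀ (G : Graph n) {i j} → Adj G i j → (i , j) ∈ orientations G
Adj⇒∈orientations G {i} {j} a with <-cmp (toℕ i) (toℕ j)
... | tri< i<j _ _ = ∈-++⁺ˡ (∈-edgeList⁺ G i<j a)
... | tri≈ _ i≡j _ = ⊥-elim (Adj-irrefl G (subst (Adj G i) (sym (toℕ-injective i≡j)) a))
... | tri> _ _ j<i = ∈-++⁺ʳ (edgeList G) (∈-map⁺ swap (∈-edgeList⁺ G j<i (Adj-sym G a)))

edges-cong : ∀ (G H : Graph n) → (∀ i j → adj G i j ≡ adj H i j) → edges G ≡ edges H
edges-cong {n} G H G≗H = cong sum (map-cong (λ i → cong sum (map-cong (λ j →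
  cong (λ b → if (toℕ i <ᵇ toℕ j) ∧ b then 1 else 0) (G≗H i j)) (allFin n))) (allFin n))

module _ {n} (G : Graph n) (L : List (Fin n × Fin n)) where
  open DecMembership (×-≡-dec (Fin._≟_ {n}) (Fin._≟_ {n})) using (_∈?_)

  restrict : Graph n
  restrict = record
    { adj    = λ i j → adj G i j ∧ (does ((i , j) ∈? L) ∨ does ((j , i) ∈? L))
    ; sym    = λ i j → cong₂ _∧_ (adj-sym G i j) (∨-comm (does ((i , j) ∈? L)) _)
    ; irrefl = λ i → cong (_∧ _) (irrefl G i)
    }

  restrict-⊆ : restrict ⊆G G
  restrict-⊆ i j a = ∧-conicalˡ _ _ a

  Adj-restrict⁺ : ∀ {i j} → Adj G i j → (i , j) ∈ L → Adj restrict i j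
  Adj-restrict⁺ {i} {j} a ij∈L rewrite a | dec-true ((i , j) ∈? L) ij∈L = refl

  Adj-restrict⁻ : ∀ {i j} → Adj restrict i j → (i , j) ∈ L ⊎ (j , i) ∈ L
  Adj-restrict⁻ {i} {j} a with (i , j) ∈? L | (j , i) ∈? L
  ... | yes ij∈L | _       = inj₁ ij∈L
  ... | no _     | yes ji∈L = inj₂ ji∈L
  ... | no _     | no _     with () ← trans (sym (∧-zeroʳ (adj G i j))) a

subgraph-with-edges : ∀ (G : Graph n) N → N ≤ edges G → ∃[ F ] (F ⊆G G × edges F ≡ N)
subgraph-with-edges G N N≤e = F , restrict-⊆ G L , ≤-antisym F≤L L≤F
  where
  L = take N (edgeList G)
  F = restrict G L
  L⊆E : ∀ {e} → e ∈ L → e ∈ edgeList G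
  L⊆E = ∈-take⁻ N (edgeList G)
  length-L : length L ≡ N
  length-L = trans (length-take N (edgeList G))
    (m≤n⇒m⊓n≡m (subst (N ≤_) (edges≡length-edgeList G) N≤e))
  F⊆L : ∀ {e} → e ∈ edgeList F → e ∈ L
  F⊆L {i , j} e∈ with ∈-edgeList⁻ F e∈
  ... | i<j , a with Adj-restrict⁻ G L a
  ...   | inj₁ ij∈L = ij∈L
  ...   | inj₂ ji∈L = ⊥-elim (<-asym i<j (proj₁ (∈-edgeList⁻ G (L⊆E ji∈L))))
  L⊆F : ∀ {e} → e ∈ L → e ∈ edgeList F
  L⊆F {i , j} e∈L = let (i<j , a) = ∈-edgeList⁻ G (L⊆E e∈L) in
    ∈-edgeList⁺ F i<j (Adj-restrict⁺ G L a e∈L)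
  F≤L : edges F ≤ N
  F≤L = subst₂ _≤_ (sym (edges≡length-edgeList F)) length-L (⊆⇒length-≤ (Unique-edgeList F) F⊆L)
  L≤F : N ≤ edges F
  L≤F = subst₂ _≤_ length-L (sym (edges≡length-edgeList F))
    (⊆⇒length-≤ (Unique.take⁺ N (Unique-edgeList G)) L⊆F)

HasCycle-⊆ : ∀ {F G : Graph n} {ℓ} → F ⊆G G → HasCycle F ℓ → HasCycle G ℓ
HasCycle-⊆ F⊆G (x , ys , 3≤ℓ , len , unique , linked) =
  x , ys , 3≤ℓ , len , unique , Linked.map (λ {i} {j} → F⊆G i j) linked

GirthGreaterThan-⊆ : ∀ {F G : Graph n} {g} → F ⊆G G → GirthGreaterThan G g → GirthGreaterThan F g
GirthGreaterThan-⊆ {F = F} {G} F⊆G girth ℓ ℓ≤g cycle =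
  girth ℓ ℓ≤g (HasCycle-⊆ {F = F} {G} F⊆G cycle)

infixr 5 _◅_

data Path {A : Set} (R : A → A → Set) : A → A → List A → Set where
  ε   : ∀ {u} → Path R u u []
  _◅_ : ∀ {u w v ws} → R u w → Path R w v ws → Path R u v (w ∷ ws)

module _ {R : A → A → Set} where

  Path-map : ∀ {S : A → A → Set} → (∀ {a b} → R a b → S a b) →
    ∀ {u v ws} → Path R u v ws → Path S u v ws
  Path-map f ε       = ε
  Path-map f (r ◅ p) = f r ◅ Path-map f p

  Path-close : ∀ {u v z ws} → Path R u v ws → R v z → Linked R (u ∷ ws ++ [ z ])
  Path-close ε       r′ = r′ ∷ [-]
  Path-close (r ◅ p) r′ = r ∷ Path-close p r′

  Path-suffix : ∀ {u v w ws} → w ∈ u ∷ ws → Path R u v ws → Unique (u ∷ ws) →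
    ∃[ post ] (Path R w v post × Unique (w ∷ post) × length post ≤ length ws)
  Path-suffix (here refl) p       u!        = _ , p , u! , ≤-refl
  Path-suffix (there w∈)  (r ◅ p) (_ ∷ ws!) =
    let (post , p′ , post! , ≤ws) = Path-suffix w∈ p ws! in post , p′ , post! , m≤n⇒m≤1+n ≤ws

  Path-prefix : ∀ {u v w ws} → w ∈ ws → Path R u v ws →
    ∃[ pre ] ∃[ rest ] (Path R u w pre × pre ++ rest ≡ ws × 1 ≤ length pre)
  Path-prefix (here refl) (r ◅ p) = _ ∷ [] , _ , r ◅ ε , refl , s≤s z≤n
  Path-prefix (there w∈)  (r ◅ p) =
    let (pre , rest , p′ , eq , _) = Path-prefix w∈ p in
    _ ∷ pre , rest , r ◅ p′ , cong (_ ∷_) eq , s≤s z≤n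

  module _ (_≟_ : DecidableEquality A) where
    open DecMembership _≟_ using (_∈?_)

    loop-erase : ∀ {u v ws} → Path R u v ws →
      ∃[ ws′ ] (Path R u v ws′ × Unique (u ∷ ws′) × length ws′ ≤ length ws)
    loop-erase ε = [] , ε , [] ∷ [] , z≤n
    loop-erase {u} (_◅_ {w = w} r p) with loop-erase p
    ... | ws′ , p′ , ws′! , ≤ws with u ∈? (w ∷ ws′)
    ...   | yes u∈ = let (post , p″ , post! , ≤ws′) = Path-suffix u∈ p′ ws′! in
                     post , p″ , post! , m≤n⇒m≤1+n (≤-trans ≤ws′ ≤ws)
    ...   | no u∉  = w ∷ ws′ , r ◅ p′ , Allₚ.¬Any⇒All¬ _ u∉ ∷ ws′! , s≤s ≤ws

walk⇒path : ∀ {G : Graph n} {P u v ℓ} → WalkIn G P u v ℓ →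
  ∃[ ws ] (Path (Adj G) u v ws × length ws ≡ ℓ)
walk⇒path (nil _)      = [] , ε , refl
walk⇒path (cons _ a w) = let (ws , p , len) = walk⇒path w in _ ∷ ws , a ◅ p , cong suc len

path⇒cycle : ∀ (G : Graph n) {x w ws} → Path (Adj G) x w ws → Unique (x ∷ ws) → 2 ≤ length ws →
  Adj G w x → HasCycle G (suc (length ws))
path⇒cycle G {x} {ws = ws} p x∷ws! 2≤ws w~x = x , ws , s≤s 2≤ws , refl , x∷ws! , Path-close p w~x

-- Spanners of graphs of large girth

module _ {n} (t : ℕ) (G H : Graph n) (girth : GirthGreaterThan G (suc t)) (H⊆G : H ⊆G G) where

  adjacent-by-short-path : ∀ {u v ws} → Adj G u v → Path (Adj H) u v ws → Unique (u ∷ ws) →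
    length ws ≤ t → Adj H u v
  adjacent-by-short-path u~v ε                   _  _    = ⊥-elim (Adj-irrefl G u~v)
  adjacent-by-short-path u~v (u~ᴴv ◅ ε)          _  _    = u~ᴴv
  adjacent-by-short-path u~v p@(_ ◅ _ ◅ _) u∷ws! ws≤t = ⊥-elim (girth _ (s≤s ws≤t)
    (path⇒cycle G (Path-map (λ {a} {b} → H⊆G a b) p) u∷ws! (s≤s (s≤s z≤n)) (Adj-sym G u~v)))

  spanner-keeps-edges : (∀ u v ℓ → Walk G u v ℓ → ∃[ ℓ′ ] (Walk H u v ℓ′ × ℓ′ ≤ t * ℓ)) →
    ∀ {u v} → Adj G u v → Adj H u v
  spanner-keeps-edges stretch {u} {v} u~v =
    let (ℓ , walk , ℓ≤t) = stretch u v 1 (cons tt u~v (nil tt))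
        (ws , p , len) = walk⇒path walk
        (ws′ , p′ , u∷ws′! , ws′≤ws) = loop-erase Fin._≟_ p
    in adjacent-by-short-path u~v p′ u∷ws′!
         (≤-trans ws′≤ws (≤-trans (≤-reflexive len) (≤-trans ℓ≤t (≤-reflexive (*-identityʳ t)))))

spanner-of-large-girth : ∀ {n} t (G H : Graph n) → GirthGreaterThan G (suc t) → IsSpanner t G H →
  ∀ u v → adj H u v ≡ adj G u v
spanner-of-large-girth t G H girth (H⊆G , stretch) u v with adj G u v in u~v | adj H u v in u~ᴴv
... | false | false = refl
... | true  | true  = refl
... | false | true  with () ← trans (sym u~v) (H⊆G u v u~ᴴv)
... | true  | false with () ← trans (sym u~ᴴv) (spanner-keeps-edges t G H girth H⊆G stretch u~v)

-- Forests have at most n edges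

neighbours : Graph n → Fin n → List (Fin n)
neighbours {n} G v = filterᵇ (adj G v) (allFin n)

degree : Graph n → Fin n → ℕ
degree G v = length (neighbours G v)

∈-neighbours⁺ : ∀ (G : Graph n) {v w} → Adj G v w → w ∈ neighbours G v
∈-neighbours⁺ G {v} {w} a = ∈-filter⁺ (T? ∘ adj G v) (∈-allFin w) (Equivalence.from T-≡ a)

∈-neighbours⁻ : ∀ (G : Graph n) {v w} → w ∈ neighbours G v → Adj G v w
∈-neighbours⁻ {n} G {v} w∈ = Equivalence.to T-≡ (proj₂ (∈-filter⁻ (T? ∘ adj G v) {xs = allFin n} w∈))

Unique-neighbours : ∀ (G : Graph n) v → Unique (neighbours G v)
Unique-neighbours {n} G v = Unique.filter⁺ (T? ∘ adj G v) (Unique.allFin⁺ n)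

Unique⇒length≤ : ∀ {xs : List (Fin n)} → Unique xs → length xs ≤ n
Unique⇒length≤ {n} {xs} xs! =
  subst (length xs ≤_) (length-allFin n) (⊆⇒length-≤ xs! (λ {x} _ → ∈-allFin x))

module _ {n} (G : Graph n) (δ≥2 : ∀ v → 2 ≤ degree G v) where
  open DecMembership (Fin._≟_ {n}) using (_∈?_)

  another-neighbour : ∀ x y → ∃[ w ] (Adj G x w × w ≢ y)
  another-neighbour x y with two-distinct-members (δ≥2 x) (Unique-neighbours G x)
  ... | a , b , a≢b , a∈ , b∈ with a Fin.≟ y
  ...   | yes refl = b , ∈-neighbours⁻ G b∈ , a≢b ∘ sym
  ...   | no a≢y   = a , ∈-neighbours⁻ G a∈ , a≢y

  previous : Fin n → List (Fin n) → Fin n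
  previous x []      = x
  previous x (y ∷ _) = y

  close-cycle : ∀ {x v w ws} → Path (Adj G) x v ws → Unique (x ∷ ws) → Adj G x w → w ≢ previous x ws →
    w ∈ ws → ∃[ ℓ ] HasCycle G ℓ
  close-cycle (_ ◅ _) _ _ w≢y (here w≡y) = ⊥-elim (w≢y w≡y)
  close-cycle {x} (x~y ◅ p) x∷ws! x~w _ (there w∈) with Path-prefix w∈ p
  ... | pre , rest , y⇝w , refl , 1≤pre =
    _ , path⇒cycle G (x~y ◅ y⇝w) (Unique-++⁻ˡ (x ∷ _ ∷ pre) x∷ws!) (s≤s 1≤pre) (Adj-sym G x~w)

  -- Extend the path at its head x by a neighbour other than the next vertex: either this
  -- closes a cycle or the path stays simple, and a simple path has at most n vertices.
  grow-path : ∀ fuel {x v ws} → Path (Adj G) x v ws → Unique (x ∷ ws) → n ≤ fuel + length ws →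
    ∃[ ℓ ] HasCycle G ℓ
  grow-path zero        _ x∷ws! n≤ws = ⊥-elim (<⇒≱ (Unique⇒length≤ x∷ws!) n≤ws)
  grow-path (suc fuel) {x} {ws = ws} p x∷ws! n≤ with another-neighbour x (previous x ws)
  ... | w , x~w , w≢prev with w ∈? (x ∷ ws)
  ...   | yes (here w≡x)  = ⊥-elim (Adj-irrefl G (subst (Adj G x) w≡x x~w))
  ...   | yes (there w∈)  = close-cycle p x∷ws! x~w w≢prev w∈
  ...   | no w∉          =
    grow-path fuel (Adj-sym G x~w ◅ p) (Allₚ.¬Any⇒All¬ _ w∉ ∷ x∷ws!)
      (subst (n ≤_) (sym (+-suc fuel _)) n≤)

degree≥2⇒cycle : ∀ {n} (G : Graph (suc n)) → (∀ v → 2 ≤ degree G v) → ∃[ ℓ ] HasCycle G ℓ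
degree≥2⇒cycle {n} G δ≥2 = grow-path G δ≥2 (suc n) {zero} ε ([] ∷ []) (≤-reflexive (sym (+-identityʳ _)))

forest-has-leaf : ∀ {n} (T : Graph (suc n)) → Forest T → ∃[ v ] degree T v ≤ 1
forest-has-leaf T forest with anyFin? (λ v → degree T v ≤? 1)
... | yes leaf = leaf
... | no ¬leaf =
  let (ℓ , cycle) = degree≥2⇒cycle T (λ v → ≰⇒> (¬leaf ∘ (v ,_))) in ⊥-elim (forest ℓ cycle)

infixl 6 _∖_

_∖_ : Graph (suc n) → Fin (suc n) → Graph n
G ∖ v = record
  { adj    = λ i j → adj G (punchIn v i) (punchIn v j)
  ; sym    = λ i j → adj-sym G (punchIn v i) (punchIn v j)
  ; irrefl = λ i → irrefl G (punchIn v i)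
  }

Forest-∖ : ∀ (T : Graph (suc n)) v → Forest T → Forest (T ∖ v)
Forest-∖ T v forest ℓ (x , ys , 3≤ℓ , len , unique , linked) =
  forest ℓ (punchIn v x , map (punchIn v) ys , 3≤ℓ , trans (cong suc (length-map (punchIn v) ys)) len ,
            Unique.map⁺ (punchIn-injective v _ _) unique ,
            subst (Linked (Adj T)) (cong (punchIn v x ∷_) (map-++ (punchIn v) ys [ x ])) (Linkedₚ.map⁺ linked))

orient : Fin n → Fin n → Fin n × Fin n
orient v j = if toℕ v <ᵇ toℕ j then (v , j) else (j , v)

orient-< : ∀ {v j : Fin n} → toℕ v < toℕ j → orient v j ≡ (v , j)
orient-< {v = v} {j} v<j rewrite Equivalence.to T-≡ (<⇒<ᵇ v<j) = refl

orient-> : ∀ {v j : Fin n} → toℕ j < toℕ v → orient v j ≡ (j , v)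
orient-> {v = v} {j} j<v with toℕ v <ᵇ toℕ j in v<ᵇj
... | true  = ⊥-elim (<-asym j<v (<ᵇ⇒< (toℕ v) (toℕ j) (Equivalence.from T-≡ v<ᵇj)))
... | false = refl

punchIn-onto : ∀ {v i : Fin (suc n)} → i ≢ v → ∃[ i′ ] punchIn v i′ ≡ i
punchIn-onto i≢v = _ , punchIn-punchOut (i≢v ∘ sym)

punchIn-cancel-< : ∀ (v : Fin (suc n)) {i j} → toℕ (punchIn v i) < toℕ (punchIn v j) → toℕ i < toℕ j
punchIn-cancel-< v {i} {j} lt = ≰⇒> (λ j≤i → <⇒≱ lt (punchIn-mono-≤ v j i j≤i))

edges-∖ : ∀ (T : Graph (suc n)) v → edges T ≤ degree T v + edges (T ∖ v)
edges-∖ {n} T v = begin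
  edges T                                          ≡⟨ edges≡length-edgeList T ⟩
  length (edgeList T)                              ≤⟨ ⊆⇒length-≤ (Unique-edgeList T) covered ⟩
  length (map (orient v) (neighbours T v) ++ map punchIn² (edgeList (T ∖ v)))
    ≡⟨ length-++ (map (orient v) (neighbours T v)) ⟩
  length (map (orient v) (neighbours T v)) + length (map punchIn² (edgeList (T ∖ v)))
    ≡⟨ cong₂ _+_ (length-map (orient v) (neighbours T v)) (length-map punchIn² (edgeList (T ∖ v))) ⟩
  degree T v + length (edgeList (T ∖ v))           ≡⟨ cong (degree T v +_) (edges≡length-edgeList (T ∖ v)) ⟨
  degree T v + edges (T ∖ v)                       ∎
  where
  open ≤-Reasoning
  punchIn² : Fin n × Fin n → Fin (suc n) × Fin (suc n)
  punchIn² = Product.map (punchIn v) (punchIn v)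
  covered : ∀ {e} → e ∈ edgeList T → e ∈ map (orient v) (neighbours T v) ++ map punchIn² (edgeList (T ∖ v))
  covered {i , j} e∈ with ∈-edgeList⁻ T e∈ | i Fin.≟ v | j Fin.≟ v
  ... | i<j , i~j | yes refl | _ =
    ∈-++⁺ˡ (subst (_∈ _) (orient-< i<j) (∈-map⁺ (orient v) (∈-neighbours⁺ T i~j)))
  ... | i<j , i~j | no _ | yes refl =
    ∈-++⁺ˡ (subst (_∈ _) (orient-> i<j) (∈-map⁺ (orient v) (∈-neighbours⁺ T (Adj-sym T i~j))))
  ... | i<j , i~j | no i≢v | no j≢v
    with i′ , refl ← punchIn-onto i≢v | j′ , refl ← punchIn-onto j≢v =
    ∈-++⁺ʳ _ (∈-map⁺ punchIn² (∈-edgeList⁺ (T ∖ v) (punchIn-cancel-< v i<j) i~j))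

edges-forest : ∀ {n} (T : Graph n) → Forest T → edges T ≤ n
edges-forest {zero}  T _      = ≤-reflexive (edges≡length-edgeList T)
edges-forest {suc n} T forest =
  let (v , leaf) = forest-has-leaf T forest in
  ≤-trans (edges-∖ T v) (+-mono-≤ leaf (edges-forest (T ∖ v) (Forest-∖ T v forest)))

-- Block embeddings and disjoint copies

-- Walks, and hence cycles and the branch sets of a complete minor, stay inside one block,
-- on which proj is injective; so they are reproduced in F.
record BlockEmbedding {n m} (G : Graph n) (F : Graph m) : Set where
  field
    block          : Fin n → ℕ
    proj           : Fin n → Fin m
    adj-block      : ∀ {x y} → Adj G x y → block x ≡ block y
    adj-proj       : ∀ {x y} → Adj G x y → Adj F (proj x) (proj y)
    proj-injective : ∀ {x y} → block x ≡ block y → proj x ≡ proj y → x ≡ y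

module _ {n m} {G : Graph n} {F : Graph m} (E : BlockEmbedding G F) where
  open BlockEmbedding E

  walk-block : ∀ {P u v ℓ} → WalkIn G P u v ℓ → block u ≡ block v
  walk-block (nil _)      = refl
  walk-block (cons _ a w) = trans (adj-block a) (walk-block w)

  linked-block : ∀ {x xs} → Linked (Adj G) (x ∷ xs) → All (λ z → block z ≡ block x) (x ∷ xs)
  linked-block [-]          = refl ∷ []
  linked-block (a ∷ linked) = refl ∷ All.map (λ eq → trans eq (sym (adj-block a))) (linked-block linked)

  HasCycle-proj : ∀ {ℓ} → HasCycle G ℓ → HasCycle F ℓ
  HasCycle-proj (x , ys , 3≤ℓ , len , unique , linked) =
    proj x , map proj ys , 3≤ℓ , trans (cong suc (length-map proj ys)) len ,
    Unique-map⁺-on proj (λ bx by → proj-injective (trans bx (sym by)))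
      (Allₚ.++⁻ˡ (x ∷ ys) (linked-block linked)) unique ,
    subst (Linked (Adj F)) (cong (proj x ∷_) (map-++ proj ys [ x ])) (Linkedₚ.map⁺ (Linked.map adj-proj linked))

  GirthGreaterThan-proj : ∀ {g} → GirthGreaterThan F g → GirthGreaterThan G g
  GirthGreaterThan-proj girth ℓ ℓ≤g = girth ℓ ℓ≤g ∘ HasCycle-proj

  -- The ordered pairs of distinct branch sets, enumerated as (i , punchIn i j), get distinct arcs.
  minor⇒edges : ∀ {h} → HasCompleteMinor G h → h * (h ∸ 1) ≤ 2 * edges F
  minor⇒edges {zero}  _ = z≤n
  minor⇒edges {suc h} (φ , nonempty , connected , adjacent) =
    subst₂ _≤_ size (length-orientations F)
      (injectiveOn⇒length-≤ arc (Unique.cartesianProduct⁺ (Unique.allFin⁺ _) (Unique.allFin⁺ h))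
        (λ {(i , j)} _ → Adj⇒∈orientations F (adj-proj (edge i j .a~b))) injective)
    where
    v₀ = proj₁ (nonempty zero)
    φv₀ = proj₂ (nonempty zero)

    in-block₀ : ∀ {i u} → φ u ≡ just i → block u ≡ block v₀
    in-block₀ {i} {u} φu with i Fin.≟ zero
    ... | yes refl = walk-block (proj₂ (connected zero u v₀ φu φv₀))
    ... | no i≢0 =
      let (a , b , φa , φb , a~b) = adjacent i zero i≢0 in
      trans (walk-block (proj₂ (connected i u a φu φa)))
        (trans (adj-block a~b) (walk-block (proj₂ (connected zero b v₀ φb φv₀))))

    branch-injective : ∀ {i i′ u u′} → φ u ≡ just i → φ u′ ≡ just i′ →
      proj u ≡ proj u′ → i ≡ i′
    branch-injective φu φu′ eq = just-injective (trans (sym φu)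
      (trans (cong φ (proj-injective (trans (in-block₀ φu) (sym (in-block₀ φu′))) eq)) φu′))

    record Edge (i j : Fin (suc h)) : Set where
      field
        {a b} : Fin n
        φa    : φ a ≡ just i
        φb    : φ b ≡ just j
        a~b   : Adj G a b
    open Edge

    edge : ∀ i j → Edge i (punchIn i j)
    edge i j = let (_ , _ , φa , φb , a~b) = adjacent i (punchIn i j) (punchInᵢ≢i i j ∘ sym) in
      record { φa = φa ; φb = φb ; a~b = a~b }

    arc : Fin (suc h) × Fin h → Fin m × Fin m
    arc (i , j) = proj (edge i j .a) , proj (edge i j .b)

    injective : ∀ {x y} → x ∈ _ → y ∈ _ → arc x ≡ arc y → x ≡ y
    injective {i , j} {i′ , j′} _ _ eq
      with refl ← branch-injective (edge i j .φa) (edge i′ j′ .φa) (cong proj₁ eq)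
      = cong (i ,_) (punchIn-injective i j j′ (branch-injective (edge i j .φb) (edge i j′ .φb) (cong proj₂ eq)))

    size : length (cartesianProduct (allFin (suc h)) (allFin h)) ≡ suc h * h
    size = trans (length-cartesianProduct (allFin (suc h)) (allFin h))
                 (cong₂ _*_ (length-allFin (suc h)) (length-allFin h))

  KMinorFree-proj : ∀ {h} → 2 * edges F < h * (h ∸ 1) → KMinorFree G h
  KMinorFree-proj few minor = <⇒≱ few (minor⇒edges minor)

≡ᵇ-sym : ∀ a b → (a ≡ᵇ b) ≡ (b ≡ᵇ a)
≡ᵇ-sym zero    zero    = refl
≡ᵇ-sym zero    (suc b) = refl
≡ᵇ-sym (suc a) zero    = refl
≡ᵇ-sym (suc a) (suc b) = ≡ᵇ-sym a b

-- Vertex x is vertex x mod m of copy x / m; if m ∤ n the last copy is an induced subgraph of F.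
module _ {m} .{{_ : NonZero m}} (F : Graph m) (n : ℕ) where

  copy : Fin n → ℕ
  copy x = toℕ x / m

  position : Fin n → Fin m
  position x = toℕ x mod m

  copies : Graph n
  copies = record
    { adj    = λ x y → adj F (position x) (position y) ∧ (copy x ≡ᵇ copy y)
    ; sym    = λ x y → cong₂ _∧_ (adj-sym F (position x) (position y)) (≡ᵇ-sym (copy x) (copy y))
    ; irrefl = λ x → cong (_∧ (copy x ≡ᵇ copy x)) (irrefl F (position x))
    }

  toℕ≡position+copy*m : ∀ x → toℕ x ≡ toℕ (position x) + copy x * m
  toℕ≡position+copy*m x =
    trans (m≡m%n+[m/n]*n (toℕ x) m) (cong (_+ copy x * m) (sym (toℕ-fromℕ< (m%n<n (toℕ x) m))))

  copies-embedding : BlockEmbedding copies F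
  copies-embedding = record
    { block          = copy
    ; proj           = position
    ; adj-block      = λ {x} {y} a → ≡ᵇ⇒≡ (copy x) (copy y) (Equivalence.from T-≡ (∧-conicalʳ _ _ a))
    ; adj-proj       = λ a → ∧-conicalˡ _ _ a
    ; proj-injective = λ {x} {y} cx≡cy px≡py → toℕ-injective (begin
        toℕ x                              ≡⟨ toℕ≡position+copy*m x ⟩
        toℕ (position x) + copy x * m      ≡⟨ cong₂ (λ p c → toℕ p + c * m) px≡py cx≡cy ⟩
        toℕ (position y) + copy y * m      ≡⟨ toℕ≡position+copy*m y ⟨
        toℕ y                              ∎)
    }
    where open ≡-Reasoning

  Adj-copies⁺ : ∀ {x y} → Adj F (position x) (position y) → copy x ≡ copy y → Adj copies x y
  Adj-copies⁺ {x} {y} a cx≡cy rewrite a | cx≡cy = Equivalence.to T-≡ (≡⇒≡ᵇ (copy y) (copy y) refl)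

  at : ∀ (β : Fin (n / m)) (ρ : Fin m) → Fin n
  at β ρ = fromℕ< (begin-strict
    toℕ ρ + toℕ β * m  <⟨ +-monoˡ-< (toℕ β * m) (toℕ<n ρ) ⟩
    m + toℕ β * m      ≤⟨ *-monoˡ-≤ m (toℕ<n β) ⟩
    n / m * m          ≤⟨ m/n*n≤m n m ⟩
    n                  ∎)
    where open ≤-Reasoning

  toℕ-at : ∀ β ρ → toℕ (at β ρ) ≡ toℕ ρ + toℕ β * m
  toℕ-at β ρ = toℕ-fromℕ< _

  copy-at : ∀ β ρ → copy (at β ρ) ≡ toℕ β
  copy-at β ρ = begin
    toℕ (at β ρ) / m               ≡⟨ cong (_/ m) (toℕ-at β ρ) ⟩
    (toℕ ρ + toℕ β * m) / m        ≡⟨ +-distrib-/-∣ʳ (toℕ ρ) (n∣m*n (toℕ β)) ⟩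
    toℕ ρ / m + toℕ β * m / m      ≡⟨ cong₂ _+_ (m<n⇒m/n≡0 (toℕ<n ρ)) (m*n/n≡m (toℕ β) m) ⟩
    toℕ β                          ∎
    where open ≡-Reasoning

  position-at : ∀ β ρ → position (at β ρ) ≡ ρ
  position-at β ρ = toℕ-injective (begin
    toℕ (toℕ (at β ρ) mod m)       ≡⟨ toℕ-fromℕ< _ ⟩
    toℕ (at β ρ) % m               ≡⟨ cong (_% m) (toℕ-at β ρ) ⟩
    (toℕ ρ + toℕ β * m) % m        ≡⟨ [m+kn]%n≡m%n (toℕ ρ) (toℕ β) m ⟩
    toℕ ρ % m                      ≡⟨ m<n⇒m%n≡m (toℕ<n ρ) ⟩
    toℕ ρ                          ∎)
    where open ≡-Reasoning

  copies-edges : n / m * edges F ≤ edges copies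
  copies-edges = subst₂ _≤_ size (sym (edges≡length-edgeList copies))
    (injectiveOn⇒length-≤ lift (Unique.cartesianProduct⁺ (Unique.allFin⁺ _) (Unique-edgeList F)) into injective)
    where
    lift : Fin (n / m) × (Fin m × Fin m) → Fin n × Fin n
    lift (β , ρ , ρ′) = at β ρ , at β ρ′

    into : ∀ {e} → e ∈ cartesianProduct (allFin (n / m)) (edgeList F) → lift e ∈ edgeList copies
    into {β , ρ , ρ′} e∈ =
      let (ρ<ρ′ , ρ~ρ′) = ∈-edgeList⁻ F (proj₂ (∈-cartesianProduct⁻ (allFin _) (edgeList F) e∈)) in
      ∈-edgeList⁺ copies
        (subst₂ _<_ (sym (toℕ-at β ρ)) (sym (toℕ-at β ρ′)) (+-monoˡ-< (toℕ β * m) ρ<ρ′))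
        (Adj-copies⁺ (subst₂ (Adj F) (sym (position-at β ρ)) (sym (position-at β ρ′)) ρ~ρ′)
                     (trans (copy-at β ρ) (sym (copy-at β ρ′))))

    at-injective : ∀ {β β′ ρ ρ′} → at β ρ ≡ at β′ ρ′ → β ≡ β′ × ρ ≡ ρ′
    at-injective {β} {β′} {ρ} {ρ′} eq =
      toℕ-injective (trans (sym (copy-at β ρ)) (trans (cong copy eq) (copy-at β′ ρ′))) ,
      trans (sym (position-at β ρ)) (trans (cong position eq) (position-at β′ ρ′))

    injective : ∀ {e e′} → e ∈ _ → e′ ∈ _ → lift e ≡ lift e′ → e ≡ e′
    injective {β , ρ₁ , ρ₂} {β′ , ρ₁′ , ρ₂′} _ _ eq
      with refl , refl ← at-injective {β} {β′} {ρ₁} {ρ₁′} (cong proj₁ eq)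
      with refl ← proj₂ (at-injective {β} {β} {ρ₂} {ρ₂′} (cong proj₂ eq)) = refl

    size : length (cartesianProduct (allFin (n / m)) (edgeList F)) ≡ n / m * edges F
    size = trans (length-cartesianProduct (allFin (n / m)) (edgeList F))
      (cong₂ _*_ (length-allFin (n / m)) (sym (edges≡length-edgeList F)))

-- Lower bounds from disjoint copies of a graph of large girth

spanner-bounds : ∀ {n} t (G : Graph n) → GirthGreaterThan G (suc t) → ∀ {a c e} →
  a * n ^ e ≤ c * edges G ^ e →
  ∀ H → IsSpanner t G H →
    (a * n ^ e ≤ c * edges H ^ e) × (∀ T → IsMSF G T → a * edges T ^ e ≤ c * edges H ^ e)
spanner-bounds {n} t G girth {a} {c} {e} dense H spanner = dense′ , λ T msf →
  ≤-trans (*-monoʳ-≤ a (^-monoˡ-≤ e (edges-forest T (proj₁ (proj₂ (proj₁ msf)))))) dense′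
  where
  dense′ : a * n ^ e ≤ c * edges H ^ e
  dense′ = subst (λ x → a * n ^ e ≤ c * x ^ e)
    (edges-cong G H (λ u v → sym (spanner-of-large-girth t G H girth spanner u v))) dense

copies-bounds : ∀ {m} .{{_ : NonZero m}} (F : Graph m) t h {a c e} →
  GirthGreaterThan F (suc t) → 2 * edges F < h * (h ∸ 1) →
  ∀ n → a * n ^ e ≤ c * (n / m * edges F) ^ e →
  ∃[ G ] (KMinorFree {n} G h × (∀ H → IsSpanner t G H →
    (a * n ^ e ≤ c * edges H ^ e) × (∀ T → IsMSF G T → a * edges T ^ e ≤ c * edges H ^ e)))
copies-bounds F t h {a} {c} {e} girth few n dense =
  copies F n , KMinorFree-proj (copies-embedding F n) few ,
  spanner-bounds t (copies F n) (GirthGreaterThan-proj (copies-embedding F n) girth) {a} {c} {e}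
    (≤-trans dense (*-monoʳ-≤ c (^-monoˡ-≤ e (copies-edges F n))))

^-distribʳ-* : ∀ a b e → (a * b) ^ e ≡ a ^ e * b ^ e
^-distribʳ-* a b zero    = refl
^-distribʳ-* a b (suc e) = trans (cong (a * b *_) (^-distribʳ-* a b e)) (interchange a b (a ^ e) (b ^ e))
  where
  interchange : ∀ a b x y → a * b * (x * y) ≡ a * x * (b * y)
  interchange = solve-∀

^-cancelʳ-≤ : ∀ e .{{_ : NonZero e}} {a b} → a ^ e ≤ b ^ e → a ≤ b
^-cancelʳ-≤ e {a} {b} le = ≮⇒≥ (λ b<a → <⇒≱ (^-monoˡ-< e b<a) le)

n≤n^[1+e] : ∀ {n} e → 1 ≤ n → n ≤ n ^ suc e
n≤n^[1+e] {n} e 1≤n = subst (_≤ n * n ^ e) (*-identityʳ n) (*-monoʳ-≤ n (m^n>0 n {{>-nonZero 1≤n}} e))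

h*h≤2*[h*[h∸1]] : ∀ h → 2 ≤ h → h * h ≤ 2 * (h * (h ∸ 1))
h*h≤2*[h*[h∸1]] (suc zero)    (s≤s ())
h*h≤2*[h*[h∸1]] (suc (suc x)) _ = subst (2+x * 2+x ≤_) (sym (split x)) (m≤m+n (2+x * 2+x) _)
  where
  2+x = suc (suc x)
  split : ∀ x → 2 * ((2 + x) * (1 + x)) ≡ (2 + x) * (2 + x) + (2 + x) * x
  split = solve-∀

n≤2*[n/m*m] : ∀ {m} .{{_ : NonZero m}} n → m ≤ n → n ≤ 2 * (n / m * m)
n≤2*[n/m*m] {m} n m≤n = begin
  n                          ≡⟨ m≡m%n+[m/n]*n n m ⟩
  n % m + n / m * m          ≤⟨ +-monoˡ-≤ (n / m * m) (<⇒≤ (≤-trans (m%n<n n m) m≤n/m*m)) ⟩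
  n / m * m + n / m * m      ≡⟨ cong (n / m * m +_) (+-identityʳ (n / m * m)) ⟨
  2 * (n / m * m)            ∎
  where
  open ≤-Reasoning
  m≤n/m*m : m ≤ n / m * m
  m≤n/m*m = m≤n*m m (n / m) {{>-nonZero (m≥n⇒m/n>0 m≤n)}}

h^2≤4*[2*s]^e : ∀ {h s} e → 2 ≤ h → 1 ≤ s → h * (h ∸ 1) ≤ 2 * suc s ^ e → h ^ 2 ≤ 4 * (2 * s) ^ e
h^2≤4*[2*s]^e {h} {s} e 2≤h 1≤s crowded = begin
  h ^ 2                      ≡⟨ cong (h *_) (*-identityʳ h) ⟩
  h * h                      ≤⟨ h*h≤2*[h*[h∸1]] h 2≤h ⟩
  2 * (h * (h ∸ 1))          ≤⟨ *-monoʳ-≤ 2 crowded ⟩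
  2 * (2 * suc s ^ e)        ≤⟨ *-monoʳ-≤ 2 (*-monoʳ-≤ 2 (^-monoˡ-≤ e (+-monoˡ-≤ s 1≤s))) ⟩
  2 * (2 * (s + s) ^ e)      ≡⟨ cong (λ x → 2 * (2 * x ^ e)) (cong (s +_) (+-identityʳ s)) ⟨
  2 * (2 * (2 * s) ^ e)      ≡⟨ *-assoc 2 2 ((2 * s) ^ e) ⟨
  4 * (2 * s) ^ e            ∎
  where open ≤-Reasoning

copies-density : ∀ k {q s h} n .{{_ : NonZero (q * s ^ k)}} → 1 ≤ s → 2 ≤ h →
  h * (h ∸ 1) ≤ 2 * suc s ^ (k + 1) → q * s ^ k ≤ n →
  h ^ 2 * n ^ (k + 1) ≤ 4 * (4 * q) ^ (k + 1) * (n / (q * s ^ k) * s ^ (k + 1)) ^ (k + 1)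
copies-density k {q} {s} {h} n 1≤s 2≤h crowded m≤n = begin
  h ^ 2 * n ^ e                                ≤⟨ *-mono-≤ (h^2≤4*[2*s]^e e 2≤h 1≤s crowded)
                                                           (^-monoˡ-≤ e (n≤2*[n/m*m] n m≤n)) ⟩
  4 * (2 * s) ^ e * (2 * (b * m)) ^ e          ≡⟨ *-assoc 4 ((2 * s) ^ e) _ ⟩
  4 * ((2 * s) ^ e * (2 * (b * m)) ^ e)        ≡⟨ cong (4 *_) (^-distribʳ-* (2 * s) (2 * (b * m)) e) ⟨
  4 * ((2 * s) * (2 * (b * m))) ^ e            ≡⟨ cong (λ x → 4 * x ^ e) regroup ⟩
  4 * ((4 * q) * (b * s ^ e)) ^ e              ≡⟨ cong (4 *_) (^-distribʳ-* (4 * q) (b * s ^ e) e) ⟩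
  4 * ((4 * q) ^ e * (b * s ^ e) ^ e)          ≡⟨ *-assoc 4 ((4 * q) ^ e) _ ⟨
  4 * (4 * q) ^ e * (b * s ^ e) ^ e            ∎
  where
  open ≤-Reasoning
  e = k + 1
  m = q * s ^ k
  b = n / m
  shuffle : ∀ s b q x → 2 * s * (2 * (b * (q * x))) ≡ 4 * q * (b * (x * s))
  shuffle = solve-∀
  regroup : (2 * s) * (2 * (b * m)) ≡ (4 * q) * (b * s ^ e)
  regroup = trans (shuffle s b q (s ^ k))
    (cong (λ x → 4 * q * (b * x)) (sym (trans (^-distribˡ-+-* s k 1) (cong (s ^ k *_) (*-identityʳ s)))))

erdős-edges : ∀ k .{{_ : NonZero k}} {p q s E} .{{_ : NonZero q}} → 1 ≤ p →
  p * (q * s ^ k) ^ (k + 1) ≤ q * E ^ k → s ^ (k + 1) ≤ E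
erdős-edges k {p} {q} {s} {E} 1≤p dense = ^-cancelʳ-≤ k (*-cancelˡ-≤ q (begin
  q * (s ^ (k + 1)) ^ k                 ≡⟨ cong (q *_) exponents ⟩
  q * (s ^ k) ^ (k + 1)                 ≤⟨ *-monoˡ-≤ ((s ^ k) ^ (k + 1)) q≤pq^e ⟩
  p * q ^ (k + 1) * (s ^ k) ^ (k + 1)   ≡⟨ *-assoc p _ _ ⟩
  p * (q ^ (k + 1) * (s ^ k) ^ (k + 1)) ≡⟨ cong (p *_) (^-distribʳ-* q (s ^ k) (k + 1)) ⟨
  p * (q * s ^ k) ^ (k + 1)             ≤⟨ dense ⟩
  q * E ^ k                             ∎))
  where
  open ≤-Reasoning
  exponents : (s ^ (k + 1)) ^ k ≡ (s ^ k) ^ (k + 1)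
  exponents = begin-equality
    (s ^ (k + 1)) ^ k   ≡⟨ ^-*-assoc s (k + 1) k ⟩
    s ^ ((k + 1) * k)   ≡⟨ cong (s ^_) (*-comm (k + 1) k) ⟩
    s ^ (k * (k + 1))   ≡⟨ ^-*-assoc s k (k + 1) ⟨
    (s ^ k) ^ (k + 1)   ∎
  q≤pq^e : q ≤ p * q ^ (k + 1)
  q≤pq^e = ≤-trans (subst (λ e → q ≤ q ^ e) (+-comm 1 k) (n≤n^[1+e] k (>-nonZero⁻¹ q)))
                   (subst (_≤ p * q ^ (k + 1)) (*-identityˡ _) (*-monoˡ-≤ (q ^ (k + 1)) 1≤p))

last-satisfying : ∀ {P : ℕ → Set} → (∀ x → Dec (P x)) → ∀ {a b} → a ≤ b → P a → ¬ P b →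
  ∃[ s ] (a ≤ s × P s × ¬ P (suc s))
last-satisfying {P} P? {a} {b} a≤b Pa ¬Pb =
  go (b ∸ a) ≤-refl Pa (subst (¬_ ∘ P) (sym (m∸n+n≡m a≤b)) ¬Pb)
  where
  go : ∀ d {x} → a ≤ x → P x → ¬ P (d + x) → ∃[ s ] (a ≤ s × P s × ¬ P (suc s))
  go zero    _       Px ¬Px = ⊥-elim (¬Px Px)
  go (suc d) {x} a≤x Px ¬P[d+x] with P? (suc x)
  ... | no ¬P[1+x] = x , a≤x , Px , ¬P[1+x]
  ... | yes P[1+x] = go d (m≤n⇒m≤1+n a≤x) P[1+x] (subst (¬_ ∘ P) (sym (+-suc d x)) ¬P[d+x])

choose-scale : ∀ e → 2 ≤ e → ∀ {a h} → 1 ≤ a → 2 * a ^ e + 2 ≤ h →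
  ∃[ s ] (a ≤ s × 2 * s ^ e < h * (h ∸ 1) × h * (h ∸ 1) ≤ 2 * suc s ^ e)
choose-scale (suc zero) (s≤s ())
choose-scale e@(suc (suc e′)) _ {a} {zero} 1≤a large with () ← ≤-trans (m≤n+m 2 (2 * a ^ e)) large
choose-scale e@(suc (suc e′)) _ {a} {h@(suc h′)} 1≤a large =
  let (s , a≤s , sparse , ¬sparse) = last-satisfying (λ s → 2 * s ^ e <? h * h′) a≤h sparse-a sparse-h
  in s , a≤s , sparse , ≮⇒≥ ¬sparse
  where
  open ≤-Reasoning
  sparse-a : 2 * a ^ e < h * h′
  sparse-a = begin-strict
    2 * a ^ e      <⟨ s≤s⁻¹ (subst (_≤ h) (+-comm _ 2) large) ⟩
    h′             ≤⟨ m≤n*m h′ h ⟩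
    h * h′         ∎
  sparse-h : ¬ 2 * h ^ e < h * h′
  sparse-h = ≤⇒≯ (begin
    h * h′         ≤⟨ *-monoʳ-≤ h (n≤1+n h′) ⟩
    h * h          ≤⟨ *-monoʳ-≤ h (n≤n^[1+e] e′ (s≤s z≤n)) ⟩
    h ^ e          ≤⟨ m≤n*m (h ^ e) 2 ⟩
    2 * h ^ e      ∎)
  a≤h : a ≤ h
  a≤h = begin
    a              ≤⟨ n≤n^[1+e] (suc e′) 1≤a ⟩
    a ^ e          ≤⟨ m≤n*m (a ^ e) 2 ⟩
    2 * a ^ e      ≤⟨ m≤m+n (2 * a ^ e) 2 ⟩
    2 * a ^ e + 2  ≤⟨ large ⟩
    h              ∎

theorem7 : ErdosGirthConjecture →
    ∀ k → 1 ≤ k →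
      ∃[ p ] ∃[ q ] (1 ≤ p × 1 ≤ q × ∃[ h₀ ] (∀ h → h₀ ≤ h →
        ∃[ n₀ ] (∀ n → n₀ ≤ n →
          ∃[ G ] (KMinorFree {n} G h ×
            (∀ H → IsSpanner (2 * k ∸ 1) G H →
              (p * h ^ 2 * n ^ (k + 1) ≤ q * edges H ^ (k + 1)) ×
              (∀ T → IsMSF G T →
                p * h ^ 2 * edges T ^ (k + 1) ≤ q * edges H ^ (k + 1)))))))
theorem7 conjecture k@(suc k′) 1≤k with conjecture k 1≤k
... | p , q@(suc _) , 1≤p , _ , n₀ , erdős =
  1 , c , ≤-refl , ≤-trans (m^n>0 (4 * q) (k + 1)) (m≤n*m _ 4) , 2 * suc n₀ ^ (k + 1) + 2 ,
  λ h large →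
  let (s , n₀<s , sparse , crowded) = choose-scale (k + 1) (s≤s (m≤n+m 1 k′)) (s≤s z≤n) large
      1≤s = ≤-trans (s≤s z≤n) n₀<s
      s≤m = ≤-trans (n≤n^[1+e] k′ 1≤s) (m≤n*m (s ^ k) q)
      (E , girthE , denseE) = erdős (q * s ^ k) (≤-trans (n≤1+n n₀) (≤-trans n₀<s s≤m))
      (F , F⊆E , edgesF) = subgraph-with-edges E (s ^ (k + 1)) (erdős-edges k {p} {q} {s} 1≤p denseE)
      instance _ = >-nonZero (≤-trans 1≤s s≤m)
  in q * s ^ k , λ n m≤n →
     copies-bounds F (2 * k ∸ 1) h {1 * h ^ 2} {c} {k + 1}
       (GirthGreaterThan-⊆ {F = F} {E} F⊆E girthE)
       (subst (λ x → 2 * x < h * (h ∸ 1)) (sym edgesF) sparse) n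
       (subst₂ (λ a x → a * n ^ (k + 1) ≤ c * (n / (q * s ^ k) * x) ^ (k + 1))
               (sym (*-identityˡ (h ^ 2))) (sym edgesF)
               (copies-density k n 1≤s (≤-trans (m≤n+m 2 _) large) crowded m≤n))
  where
  c = 4 * (4 * q) ^ (k + 1)
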